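{- For every integer $d\ge 1$, the set $S=\{00,11,22,\dots,(d-1)(d-1)\}$ is a determining set for $\vec{\mathcal B}(d,2)$.
   Context: $\mathcal A_d=\{0,1,\dots,d-1\}$; $ii$ denotes the length-2 string with both letters equal to $i$. The directed de Bruijn graph $\vec{\mathcal B}(d,2)$ has vertex set $\mathcal A_d^2$ and an arc from $x_1x_2$ to $y_1y_2$ iff $x_2=y_1$. An automorphism of a directed graph is a permutation $\pi$ of the vertices such that $(u,v)$ is an arc iff $(\pi(u),\pi(v))$ is an arc. A determining set is a vertex set $S$ such that the only automorphism fixing every vertex of $S$ is the identity. -}

module Defs where

open import Data.Nat using (ℕ)
open import Data.Fin using (Fin)
open import Data.Product using (_×_; _,_; proj₁; proj₂)
open import Relation.Binary.PropositionalEquality using (_≡_)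
open import Function.Bundles using (_↔_; Inverse)
open import Function.Bundles using (_⇔_)

-- Alphabet A_d = Fin d; vertices of B(d,2) are length-2 strings x₁x₂, i.e. pairs.
Vertex : ℕ → Set
Vertex d = Fin d × Fin d

Arc : (d : ℕ) → Vertex d → Vertex d → Set
Arc d (x₁ , x₂) (y₁ , y₂) = x₂ ≡ y₁

record Automorphism (d : ℕ) : Set where
  field
    perm : Vertex d ↔ Vertex d
    preserves : ∀ u v → Arc d u v ⇔ Arc d (Inverse.to perm u) (Inverse.to perm v)

IsDeterminingSet : (d : ℕ) → (Vertex d → Set) → Set
IsDeterminingSet d S =
  (φ : Automorphism d) →
  (∀ v → S v → Inverse.to (Automorphism.perm φ) v ≡ v) →
  ∀ v → Inverse.to (Automorphism.perm φ) v ≡ v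

Diagonal : (d : ℕ) → Vertex d → Set
Diagonal d v = proj₁ v ≡ proj₂ v

module Submission where

-- Every vertex ab of the de Bruijn graph B(d,2) lies on the
-- two-step walk  aa → ab → bb  between the loops at aa and bb.  An arc
-- x → y forces the first letter of y to equal the last letter of x, so an
-- arc-preserving map f that fixes aa must send ab to a vertex whose first
-- letter is a (the arc aa → ab is carried to aa → f(ab)); symmetrically,
-- if f fixes bb then the arc ab → bb is carried to f(ab) → bb, forcing the
-- last letter of f(ab) to be b.  Hence f(ab) = ab.

open import Defs
open import Data.Nat using (ℕ; _≥_)
open import Data.Product using (_,_; proj₁; proj₂)
open import Relation.Binary.PropositionalEquality using (_≡_; refl; sym; subst; cong₂)
open import Function.Bundles using (Inverse; Equivalence)

ArcPreserving : (d : ℕ) → (Vertex d → Vertex d) → Set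
ArcPreserving d f = ∀ u v → Arc d u v → Arc d (f u) (f v)

automorphism-arcPreserving : ∀ {d} (φ : Automorphism d) →
  ArcPreserving d (Inverse.to (Automorphism.perm φ))
automorphism-arcPreserving φ u v = Equivalence.to (Automorphism.preserves φ u v)

-- If f preserves arcs and fixes the loop aa, then f(ab) starts with a:
-- the arc aa → ab is sent to the arc aa → f(ab).
first-letter-fixed : ∀ {d} (f : Vertex d → Vertex d) → ArcPreserving d f →
  ∀ a b → f (a , a) ≡ (a , a) → proj₁ (f (a , b)) ≡ a
first-letter-fixed {d} f pres a b fixes-aa =
  sym (subst (λ u → Arc d u (f (a , b))) fixes-aa (pres (a , a) (a , b) refl))

-- If f preserves arcs and fixes the loop bb, then f(ab) ends with b:
-- the arc ab → bb is sent to the arc f(ab) → bb.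
last-letter-fixed : ∀ {d} (f : Vertex d → Vertex d) → ArcPreserving d f →
  ∀ a b → f (b , b) ≡ (b , b) → proj₂ (f (a , b)) ≡ b
last-letter-fixed {d} f pres a b fixes-bb =
  subst (λ u → Arc d (f (a , b)) u) fixes-bb (pres (a , b) (b , b) refl)

fixes-loops⇒identity : ∀ {d} (f : Vertex d → Vertex d) → ArcPreserving d f →
  (∀ v → Diagonal d v → f v ≡ v) → ∀ v → f v ≡ v
fixes-loops⇒identity f pres fix (a , b) =
  cong₂ _,_ (first-letter-fixed f pres a b (fix (a , a) refl))
            (last-letter-fixed  f pres a b (fix (b , b) refl))

lemma4p10 : (d : ℕ) → d ≥ 1 → IsDeterminingSet d (Diagonal d)
lemma4p10 d _ φ =
  fixes-loops⇒identity (Inverse.to (Automorphism.perm φ))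
                       (automorphism-arcPreserving φ)
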